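{- Let $G$ be a finite group. If $G$ contains an element of order $p^2$ for some odd prime $p$, or an element of order $pq$ for some distinct primes $p,q$, then $\Gamma(G)$ is not a cograph.
   Context: For a finite group $G$, the prime-order element graph $\Gamma(G)$ is the simple graph with vertex set $G$ in which two distinct vertices $x,y$ are adjacent if and only if the order of $xy$ is a prime. A cograph is a graph with no induced path on four vertices. -}

module Defs where

open import Level using (0ℓ)
open import Data.Nat using (ℕ; zero; suc; _≤_; _<_; _*_)
open import Data.Nat.Primality using (Prime)
open import Data.Fin using (Fin)
open import Data.Product using (Σ; ∃; _×_; ∃-syntax)
open import Data.Sum using (_⊎_)
open import Relation.Nullary using (¬_)
open import Relation.Binary.PropositionalEquality using (_≡_; _≢_)
open import Algebra.Structures using (IsGroup)

-- A finite group: a group structure on the finite set Fin n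
-- (every finite group is isomorphic to one of this form), with
-- propositional equality as the group equality.
record FiniteGroup : Set where
  infixl 7 _∙_
  field
    n       : ℕ
    _∙_     : Fin n → Fin n → Fin n
    ε       : Fin n
    _⁻¹     : Fin n → Fin n
    isGroup : IsGroup _≡_ _∙_ ε _⁻¹

module _ (G : FiniteGroup) where
  open FiniteGroup G

  El : Set
  El = Fin n

  pow : El → ℕ → El
  pow g zero    = ε
  pow g (suc k) = g ∙ pow g k

  HasOrder : El → ℕ → Set
  HasOrder g k = (1 ≤ k) × (pow g k ≡ ε) × (∀ j → 1 ≤ j → j < k → pow g j ≢ ε)

  Adj : El → El → Set
  Adj x y = (x ≢ y) × ∃[ p ] (Prime p × HasOrder (x ∙ y) p)

  InducedP4 : El → El → El → El → Set
  InducedP4 a b c d =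
    (a ≢ b) × (a ≢ c) × (a ≢ d) × (b ≢ c) × (b ≢ d) × (c ≢ d) ×
    Adj a b × Adj b c × Adj c d ×
    ¬ Adj a c × ¬ Adj a d × ¬ Adj b d

  IsCograph : Set
  IsCograph = ¬ (∃[ a ] ∃[ b ] ∃[ c ] ∃[ d ] InducedP4 a b c d)

-- Everything happens inside the cyclic subgroup ⟨g⟩ of an element g of order n:
-- there g^i g^j = g^(i+j), and g^s has prime order r exactly when s = k·(n/r)
-- with r ∤ k, whereas g^s = e when n ∣ s and g^s has order n when s is prime
-- to n. So an induced path g^a - g^b - g^c - g^d comes from exponents whose
-- three consecutive sums are of the first kind and the other three sums are not:
--   n = pq, q ≠ 2 :  (a, b, c, d) = (p, 0, −p, p + q),
--   n = p², p odd :  (a, b, c, d) = (1, p − 1, p + 1, −1).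
-- The hypotheses q ≠ 2 and p ≠ 2 are what keep the sums 2p + q and p ± 2
-- prime to n.
module Submission where

open import Defs
open import Data.Nat using (ℕ; zero; suc; _+_; _*_; _≤_; _<_; NonZero; >-nonZero; s≤s⁻¹; nonTrivial⇒n>1)
open import Data.Nat.Properties using (_≟_; *-comm; *-identityˡ; +-identityʳ; +-comm; ≤-refl; n<1+n; <⇒≤; <⇒≢; n≢0⇒n>0; m*n≢0⇒m≢0)
open import Data.Nat.Divisibility using (_∣_; divides; n∣m*n; m∣m*n; m*n∣⇒m∣; *-cancelˡ-∣; ∣m+n∣m⇒∣n; >⇒∤; m%n≡0⇒n∣m; ∣-refl)
open import Data.Nat.DivMod using (_%_; _/_; m≡m%n+[m/n]*n; m%n<n)
open import Data.Nat.Primality using (Prime; prime[2]; prime⇒nonTrivial; prime⇒nonZero; prime⇒irreducible; euclidsLemma)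
open import Data.Nat.Tactic.RingSolver using (solve-∀)
open import Data.Product using (_×_; _,_; proj₂; ∃-syntax)
open import Data.Sum using (_⊎_; inj₁; inj₂)
open import Relation.Nullary using (¬_; yes; no; contradiction)
open import Relation.Nullary.Decidable using (decidable-stable)
open import Relation.Binary.PropositionalEquality using (_≡_; _≢_; refl; sym; trans; cong; subst; ≢-sym; module ≡-Reasoning)
open import Algebra.Structures using (IsGroup)
open import Function using (_∘_)

prime>1 : ∀ {p} → Prime p → 1 < p
prime>1 {p} pp = nonTrivial⇒n>1 p {{prime⇒nonTrivial pp}}

prime∤1 : ∀ {p} → Prime p → ¬ p ∣ 1
prime∤1 pp = >⇒∤ (prime>1 pp)

prime∣prime⇒≡ : ∀ {p q} → Prime p → Prime q → p ∣ q → p ≡ q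
prime∣prime⇒≡ pp pq p∣q with prime⇒irreducible pq p∣q
... | inj₁ p≡1 = contradiction (sym p≡1) (<⇒≢ (prime>1 pp))
... | inj₂ p≡q = p≡q

prime∤suc : ∀ {p} → Prime p → ¬ p ∣ p + 1
prime∤suc pp p∣p+1 = prime∤1 pp (∣m+n∣m⇒∣n p∣p+1 ∣-refl)

module _ (G : FiniteGroup) where
  open FiniteGroup G
  open IsGroup isGroup using (assoc; identityˡ; identityʳ)
  open ≡-Reasoning

  infixr 8 _^_
  _^_ : El G → ℕ → El G
  _^_ = pow G

  HasPrimeOrder : El G → Set
  HasPrimeOrder x = ∃[ r ] (Prime r × HasOrder G x r)

  ^-+ : ∀ g i j → g ^ (i + j) ≡ g ^ i ∙ g ^ j
  ^-+ g zero    j = sym (identityˡ (g ^ j))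
  ^-+ g (suc i) j = trans (cong (g ∙_) (^-+ g i j)) (sym (assoc g (g ^ i) (g ^ j)))

  ^-* : ∀ g i j → (g ^ i) ^ j ≡ g ^ (j * i)
  ^-* g i zero    = refl
  ^-* g i (suc j) = trans (cong (g ^ i ∙_) (^-* g i j)) (sym (^-+ g i (j * i)))

  ε^ : ∀ k → ε ^ k ≡ ε
  ε^ zero    = refl
  ε^ (suc k) = trans (cong (ε ∙_) (ε^ k)) (identityˡ ε)

  ^≡ε-∣ : ∀ {g n s} → g ^ n ≡ ε → n ∣ s → g ^ s ≡ ε
  ^≡ε-∣ {g} {n} gⁿ≡ε (divides q refl) = begin
    g ^ (q * n)  ≡⟨ ^-* g n q ⟨
    (g ^ n) ^ q  ≡⟨ cong (_^ q) gⁿ≡ε ⟩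
    ε ^ q        ≡⟨ ε^ q ⟩
    ε            ∎

  hasOrder-∣ : ∀ {g n s} → HasOrder G g n → g ^ s ≡ ε → n ∣ s
  hasOrder-∣ {g} {n} {s} (n≥1 , gⁿ≡ε , minimal) gˢ≡ε =
    m%n≡0⇒n∣m s n (decidable-stable (s % n ≟ 0) λ s%n≢0 →
      minimal (s % n) (n≢0⇒n>0 s%n≢0) (m%n<n s n) g^[s%n]≡ε)
    where
    instance
      n≢0 : NonZero n
      n≢0 = >-nonZero n≥1
    g^[s%n]≡ε : g ^ (s % n) ≡ ε
    g^[s%n]≡ε = begin
      g ^ (s % n)                    ≡⟨ identityʳ _ ⟨
      g ^ (s % n) ∙ ε                ≡⟨ cong (g ^ (s % n) ∙_) (^≡ε-∣ gⁿ≡ε (n∣m*n (s / n))) ⟨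
      g ^ (s % n) ∙ g ^ (s / n * n)  ≡⟨ ^-+ g (s % n) (s / n * n) ⟨
      g ^ (s % n + s / n * n)        ≡⟨ cong (g ^_) (m≡m%n+[m/n]*n s n) ⟨
      g ^ s                          ≡⟨ gˢ≡ε ⟩
      ε                              ∎

  ε-¬hasPrimeOrder : ¬ HasPrimeOrder ε
  ε-¬hasPrimeOrder (r , pr , _ , _ , minimal) = minimal 1 ≤-refl (prime>1 pr) (identityʳ ε)

  ^-multiple-¬hasPrimeOrder : ∀ {g n s} → HasOrder G g n → n ∣ s → ¬ HasPrimeOrder (g ^ s)
  ^-multiple-¬hasPrimeOrder (_ , gⁿ≡ε , _) n∣s hpo =
    ε-¬hasPrimeOrder (subst HasPrimeOrder (^≡ε-∣ gⁿ≡ε n∣s) hpo)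

  ^-hasPrimeOrder : ∀ {g u r k s} → HasOrder G g (u * r) → Prime r → ¬ r ∣ k → s ≡ k * u →
                    HasPrimeOrder (g ^ s)
  ^-hasPrimeOrder {g} {u} {r} {k} ord@(ur≥1 , gᵘʳ≡ε , _) pr r∤k refl =
    r , pr , <⇒≤ (prime>1 pr) , xʳ≡ε , minimal
    where
    x : El G
    x = g ^ (k * u)
    rearrange₁ : ∀ a b c → a * (b * c) ≡ b * (c * a)
    rearrange₁ = solve-∀
    rearrange₂ : ∀ a b c → a * (b * c) ≡ c * (b * a)
    rearrange₂ = solve-∀
    xʳ≡ε : x ^ r ≡ ε
    xʳ≡ε = trans (^-* g (k * u) r) (^≡ε-∣ gᵘʳ≡ε (divides k (rearrange₁ r k u)))
    r∣kj : ∀ j → x ^ j ≡ ε → r ∣ k * j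
    r∣kj j xʲ≡ε = *-cancelˡ-∣ u {{m*n≢0⇒m≢0 u {{>-nonZero ur≥1}}}}
      (subst (u * r ∣_) (rearrange₂ j k u) (hasOrder-∣ ord (trans (sym (^-* g (k * u) j)) xʲ≡ε)))
    minimal : ∀ j → 1 ≤ j → j < r → x ^ j ≢ ε
    minimal j j≥1 j<r xʲ≡ε with euclidsLemma k j pr (r∣kj j xʲ≡ε)
    ... | inj₁ r∣k = r∤k r∣k
    ... | inj₂ r∣j = >⇒∤ {{>-nonZero j≥1}} j<r r∣j

  ^-coprime-¬hasPrimeOrder : ∀ {g p q s} → HasOrder G g (p * q) → Prime p → ¬ p ∣ s → ¬ q ∣ s →
                             ¬ HasPrimeOrder (g ^ s)
  ^-coprime-¬hasPrimeOrder {g} {p} {q} {s} ord pp p∤s q∤s (r , pr , _ , xʳ≡ε , _) = q∤s q∣s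
    where
    pq∣rs : p * q ∣ r * s
    pq∣rs = hasOrder-∣ ord (trans (sym (^-* g s r)) xʳ≡ε)
    p≡r : p ≡ r
    p≡r with euclidsLemma r s pp (m*n∣⇒m∣ p q pq∣rs)
    ... | inj₁ p∣r = prime∣prime⇒≡ pp pr p∣r
    ... | inj₂ p∣s = contradiction p∣s p∤s
    q∣s : q ∣ s
    q∣s = *-cancelˡ-∣ p {{prime⇒nonZero pp}} (subst (λ r → p * q ∣ r * s) (sym p≡r) pq∣rs)

  powers-inducedP4 : ∀ g a b c d →
    HasPrimeOrder (g ^ (a + b)) → HasPrimeOrder (g ^ (b + c)) → HasPrimeOrder (g ^ (c + d)) →
    ¬ HasPrimeOrder (g ^ (a + c)) → ¬ HasPrimeOrder (g ^ (a + d)) → ¬ HasPrimeOrder (g ^ (b + d)) →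
    InducedP4 G (g ^ a) (g ^ b) (g ^ c) (g ^ d)
  powers-inducedP4 g a b c d ab bc cd ¬ac ¬ad ¬bd =
    a≢b , a≢c , a≢d , b≢c , b≢d , c≢d ,
    (a≢b , edge a b ab) , (b≢c , edge b c bc) , (c≢d , edge c d cd) ,
    ¬edge a c ¬ac ∘ proj₂ , ¬edge a d ¬ad ∘ proj₂ , ¬edge b d ¬bd ∘ proj₂
    where
    Edge : ℕ → ℕ → Set
    Edge i j = HasPrimeOrder (g ^ (i + j))
    edge : ∀ i j → Edge i j → HasPrimeOrder (g ^ i ∙ g ^ j)
    edge i j = subst HasPrimeOrder (^-+ g i j)
    ¬edge : ∀ i j → ¬ Edge i j → ¬ HasPrimeOrder (g ^ i ∙ g ^ j)
    ¬edge i j ¬e e = ¬e (subst HasPrimeOrder (sym (^-+ g i j)) e)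
    flip : ∀ i j → Edge i j → Edge j i
    flip i j = subst (λ s → HasPrimeOrder (g ^ s)) (+-comm i j)
    ¬flip : ∀ i j → ¬ Edge i j → ¬ Edge j i
    ¬flip i j ¬e e = ¬e (flip j i e)
    distinct : ∀ i j k → Edge i k → ¬ Edge j k → g ^ i ≢ g ^ j
    distinct i j k e ¬e gⁱ≡gʲ =
      ¬edge j k ¬e (subst (λ x → HasPrimeOrder (x ∙ g ^ k)) gⁱ≡gʲ (edge i k e))
    a≢b : g ^ a ≢ g ^ b
    a≢b = ≢-sym (distinct b a c bc ¬ac)
    a≢c : g ^ a ≢ g ^ c
    a≢c = ≢-sym (distinct c a d cd ¬ad)
    a≢d : g ^ a ≢ g ^ d
    a≢d = distinct a d b ab (¬flip b d ¬bd)
    b≢c : g ^ b ≢ g ^ c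
    b≢c = distinct b c a (flip a b ab) (¬flip a c ¬ac)
    b≢d : g ^ b ≢ g ^ d
    b≢d = distinct b d a (flip a b ab) (¬flip a d ¬ad)
    c≢d : g ^ c ≢ g ^ d
    c≢d = distinct c d b (flip b c bc) (¬flip b d ¬bd)

elementOfOrder-p²⇒¬cograph : (G : FiniteGroup) → ∀ {p} → Prime p → p ≢ 2 →
                             (g : El G) → HasOrder G g (p * p) → ¬ IsCograph G
elementOfOrder-p²⇒¬cograph G {zero} pp _ _ _ = contradiction (prime>1 pp) λ ()
elementOfOrder-p²⇒¬cograph G {p@(suc m)} pp p≢2 g ord cograph =
  cograph (_ , _ , _ , _ , powers-inducedP4 G g 1 m (p + 1) (m * (p + 1))
    (^-hasPrimeOrder G ord pp (prime∤1 pp) (sym (*-identityˡ p)))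
    (^-hasPrimeOrder G ord pp p∤2 (b+c m))
    (^-hasPrimeOrder G ord pp (prime∤suc pp) (c+d m))
    (^-coprime-¬hasPrimeOrder G ord pp p∤a+c p∤a+c)
    (^-multiple-¬hasPrimeOrder G ord (divides 1 (a+d m)))
    (^-coprime-¬hasPrimeOrder G ord pp p∤b+d p∤b+d))
  where
  p∤2 : ¬ p ∣ 2
  p∤2 p∣2 = p≢2 (prime∣prime⇒≡ pp prime[2] p∣2)
  b+c : ∀ m → m + (suc m + 1) ≡ 2 * suc m
  b+c = solve-∀
  c+d : ∀ m → (suc m + 1) + m * (suc m + 1) ≡ (suc m + 1) * suc m
  c+d = solve-∀
  a+c : ∀ m → 1 + (suc m + 1) ≡ suc m + 2
  a+c = solve-∀
  a+d : ∀ m → 1 + m * (suc m + 1) ≡ 1 * (suc m * suc m)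
  a+d = solve-∀
  b+d : ∀ m → (m + m * (suc m + 1)) + 2 ≡ suc m * (suc m + 1)
  b+d = solve-∀
  p∤a+c : ¬ p ∣ 1 + (p + 1)
  p∤a+c p∣s = p∤2 (∣m+n∣m⇒∣n (subst (p ∣_) (a+c m) p∣s) ∣-refl)
  p∤b+d : ¬ p ∣ m + m * (p + 1)
  p∤b+d p∣s = p∤2 (∣m+n∣m⇒∣n (subst (p ∣_) (sym (b+d m)) (m∣m*n (p + 1))) p∣s)

elementOfOrder-pq⇒¬cograph : (G : FiniteGroup) → ∀ {p q} → Prime p → Prime q → p ≢ q → q ≢ 2 →
                             (g : El G) → HasOrder G g (p * q) → ¬ IsCograph G
elementOfOrder-pq⇒¬cograph G {q = zero} _ pq _ _ _ _ = contradiction (prime>1 pq) λ ()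
elementOfOrder-pq⇒¬cograph G {p} {q@(suc m)} pp pq p≢q q≢2 g ord cograph =
  cograph (_ , _ , _ , _ , powers-inducedP4 G g p 0 (m * p) (p + q)
    (^-hasPrimeOrder G ord pq (prime∤1 pq) (trans (+-identityʳ p) (sym (*-identityˡ p))))
    (^-hasPrimeOrder G ord pq q∤m refl)
    (^-hasPrimeOrder G ord′ pp (prime∤suc pp) (c+d p m))
    (^-multiple-¬hasPrimeOrder G ord (divides 1 (a+c p m)))
    (^-coprime-¬hasPrimeOrder G ord pp p∤a+d q∤a+d)
    (^-coprime-¬hasPrimeOrder G ord pp p∤p+q q∤p+q))
  where
  ord′ : HasOrder G g (q * p)
  ord′ = subst (HasOrder G g) (*-comm p q) ord
  q∤m : ¬ q ∣ m
  q∤m = >⇒∤ {{>-nonZero (s≤s⁻¹ (prime>1 pq))}} (n<1+n m)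
  p∤q : ¬ p ∣ q
  p∤q p∣q = p≢q (prime∣prime⇒≡ pp pq p∣q)
  q∤p : ¬ q ∣ p
  q∤p q∣p = p≢q (sym (prime∣prime⇒≡ pq pp q∣p))
  c+d : ∀ p m → m * p + (p + suc m) ≡ (p + 1) * suc m
  c+d = solve-∀
  a+c : ∀ p m → p + m * p ≡ 1 * (p * suc m)
  a+c = solve-∀
  a+d : ∀ p m → p + (p + suc m) ≡ suc m + 2 * p
  a+d = solve-∀
  p∤p+q : ¬ p ∣ p + q
  p∤p+q p∣p+q = p∤q (∣m+n∣m⇒∣n p∣p+q ∣-refl)
  q∤p+q : ¬ q ∣ p + q
  q∤p+q q∣p+q = q∤p (∣m+n∣m⇒∣n (subst (q ∣_) (+-comm p q) q∣p+q) ∣-refl)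
  p∤a+d : ¬ p ∣ p + (p + q)
  p∤a+d p∣s = p∤p+q (∣m+n∣m⇒∣n p∣s ∣-refl)
  q∤a+d : ¬ q ∣ p + (p + q)
  q∤a+d q∣s with euclidsLemma 2 p pq (∣m+n∣m⇒∣n (subst (q ∣_) (a+d p m) q∣s) ∣-refl)
  ... | inj₁ q∣2 = q≢2 (prime∣prime⇒≡ pq prime[2] q∣2)
  ... | inj₂ q∣p = q∤p q∣p

mainTheorem11 : (G : FiniteGroup) →
    ((∃[ p ] (Prime p × p ≢ 2 × ∃[ g ] HasOrder G g (p * p)))
      ⊎ (∃[ p ] ∃[ q ] (Prime p × Prime q × p ≢ q × ∃[ g ] HasOrder G g (p * q)))) →
    ¬ IsCograph G
mainTheorem11 G (inj₁ (p , pp , p≢2 , g , ord)) = elementOfOrder-p²⇒¬cograph G pp p≢2 g ord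
mainTheorem11 G (inj₂ (p , q , pp , pq , p≢q , g , ord)) with q ≟ 2
... | no q≢2  = elementOfOrder-pq⇒¬cograph G pp pq p≢q q≢2 g ord
... | yes refl =
  elementOfOrder-pq⇒¬cograph G pq pp (≢-sym p≢q) p≢q g (subst (HasOrder G g) (*-comm p 2) ord)
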